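{- Let $\mathcal{P}$ be an additive hereditary graph property that is expressible by forbidden orientations or expressible by forbidden acyclic orientations. If $cyc(\mathcal{P})$ is infinite, then there is a positive integer $M$ such that for every integer $k\ge M$: the cycle $C_k$ belongs to $\mathcal{P}$ if and only if for every positive multiple $l$ of $k$ the cycle $C_l$ belongs to $\mathcal{P}$.
   Context: Graphs are finite and simple; $C_k$ is the cycle with $k$ vertices. A graph property is a class of graphs closed under isomorphism; hereditary means closed under induced subgraphs, additive means closed under disjoint unions. An oriented graph is a digraph without loops, parallel arcs or pairs of opposite arcs; an orientation of a graph assigns a direction to each edge; it is acyclic if it has no directed cycle. For a set $F$ of oriented graphs, an oriented graph is $F$-free if no member of $F$ is isomorphic to an induced subdigraph of it. $\mathcal{P}$ is expressible by forbidden orientations if there is a finite set $F$ of oriented graphs such that a graph belongs to $\mathcal{P}$ iff it admits an $F$-free orientation; it is expressible by forbidden acyclic orientations if there is a finite $F$ such that a graph belongs to $\mathcal{P}$ iff it admits an acyclic $F$-free orientation. $cyc(\mathcal{P})$ is the set of integers $k\ge3$ with $C_k\in\mathcal{P}$. -}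

module Defs where

open import Data.Nat using (ℕ; zero; suc; _+_; _*_; _∸_; _≤_)
open import Data.Fin using (Fin; toℕ; inject₁; fromℕ; splitAt)
open import Data.Empty using (⊥)
open import Data.Sum using (_⊎_; inj₁; inj₂; swap)
open import Data.Product using (Σ; ∃; _×_; _,_)
open import Data.List using (List)
open import Data.List.Membership.Propositional using (_∈_)
open import Relation.Nullary using (¬_)
open import Relation.Binary.PropositionalEquality using (_≡_; refl) renaming (sym to sym≡)
open import Data.Nat.Properties using (suc-injective)
open import Function.Bundles using (_⇔_; mk⇔)
open import Function.Definitions using (Injective)

record Graph : Set₁ where
  field
    size   : ℕ
    E      : Fin size → Fin size → Set
    sym    : ∀ {i j} → E i j → E j i
    irrefl : ∀ {i} → ¬ E i i
open Graph public

record _≅_ (G H : Graph) : Set where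
  field
    to      : Fin (size G) → Fin (size H)
    from    : Fin (size H) → Fin (size G)
    to∘from : ∀ y → to (from y) ≡ y
    from∘to : ∀ x → from (to x) ≡ x
    adj     : ∀ x y → E G x y ⇔ E H (to x) (to y)

-- Induced subgraph on the image of f (a subgraph when f is injective)
Induced : (G : Graph) {m : ℕ} → (Fin m → Fin (size G)) → Graph
Induced G {m} f = record
  { size = m ; E = λ i j → E G (f i) (f j)
  ; sym = sym G ; irrefl = irrefl G }

UAdj : {m n : ℕ} → (Fin m → Fin m → Set) → (Fin n → Fin n → Set)
     → Fin m ⊎ Fin n → Fin m ⊎ Fin n → Set
UAdj E₁ E₂ (inj₁ a) (inj₁ b) = E₁ a b
UAdj E₁ E₂ (inj₂ a) (inj₂ b) = E₂ a b
UAdj E₁ E₂ _        _        = ⊥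

UAdj-sym : {m n : ℕ} (E₁ : Fin m → Fin m → Set) (E₂ : Fin n → Fin n → Set)
  → (∀ {i j} → E₁ i j → E₁ j i) → (∀ {i j} → E₂ i j → E₂ j i)
  → ∀ x y → UAdj E₁ E₂ x y → UAdj E₁ E₂ y x
UAdj-sym E₁ E₂ s₁ s₂ (inj₁ a) (inj₁ b) e = s₁ e
UAdj-sym E₁ E₂ s₁ s₂ (inj₂ a) (inj₂ b) e = s₂ e

UAdj-irr : {m n : ℕ} (E₁ : Fin m → Fin m → Set) (E₂ : Fin n → Fin n → Set)
  → (∀ {i} → ¬ E₁ i i) → (∀ {i} → ¬ E₂ i i)
  → ∀ x → ¬ UAdj E₁ E₂ x x
UAdj-irr E₁ E₂ r₁ r₂ (inj₁ a) e = r₁ e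
UAdj-irr E₁ E₂ r₁ r₂ (inj₂ a) e = r₂ e

_⊕_ : Graph → Graph → Graph
G ⊕ H = record
  { size = size G + size H
  ; E = λ x y → UAdj (E G) (E H) (splitAt (size G) x) (splitAt (size G) y)
  ; sym = λ {x} {y} → UAdj-sym (E G) (E H) (sym G) (sym H) (splitAt (size G) x) (splitAt (size G) y)
  ; irrefl = λ {x} → UAdj-irr (E G) (E H) (irrefl G) (irrefl H) (splitAt (size G) x) }

IsoClosed : (Graph → Set) → Set₁
IsoClosed P = ∀ G H → G ≅ H → P G → P H

Hereditary : (Graph → Set) → Set₁
Hereditary P = ∀ G {m} (f : Fin m → Fin (size G)) → Injective _≡_ _≡_ f
             → P G → P (Induced G f)

Additive : (Graph → Set) → Set₁
Additive P = ∀ G H → P G → P H → P (G ⊕ H)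

record ODigraph : Set₁ where
  field
    dsize   : ℕ
    A       : Fin dsize → Fin dsize → Set
    dirrefl : ∀ {i} → ¬ A i i
    asym    : ∀ {i j} → A i j → ¬ A j i
open ODigraph public

EmbedsInduced : ODigraph → ODigraph → Set
EmbedsInduced F D = Σ (Fin (dsize F) → Fin (dsize D)) λ f →
  Injective _≡_ _≡_ f × (∀ i j → A F i j ⇔ A D (f i) (f j))

Free : List ODigraph → ODigraph → Set₁
Free Fs D = ∀ F → F ∈ Fs → ¬ EmbedsInduced F D

record Orientation (G : Graph) : Set₁ where
  field
    arc      : Fin (size G) → Fin (size G) → Set
    arc-irr  : ∀ {i} → ¬ arc i i
    arc-asym : ∀ {i j} → arc i j → ¬ arc j i
    spans    : ∀ i j → E G i j ⇔ (arc i j ⊎ arc j i)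
open Orientation public

toDigraph : {G : Graph} → Orientation G → ODigraph
toDigraph {G} O = record
  { dsize = size G ; A = arc O ; dirrefl = arc-irr O ; asym = arc-asym O }

DirectedCycle : ODigraph → Set
DirectedCycle D = Σ ℕ λ k → Σ (Fin (suc k) → Fin (dsize D)) λ c →
  Injective _≡_ _≡_ c ×
  (∀ (i : Fin k) → A D (c (inject₁ i)) (c (Fin.suc i))) ×
  A D (c (fromℕ k)) (c Fin.zero)

Acyclic : ODigraph → Set
Acyclic D = ¬ DirectedCycle D

ExpressibleByForbiddenOrientations : (Graph → Set) → Set₁
ExpressibleByForbiddenOrientations P = Σ (List ODigraph) λ Fs →
  ∀ G → P G ⇔ Σ (Orientation G) (λ O → Free Fs (toDigraph O))

ExpressibleByForbiddenAcyclicOrientations : (Graph → Set) → Set₁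
ExpressibleByForbiddenAcyclicOrientations P = Σ (List ODigraph) λ Fs →
  ∀ G → P G ⇔ Σ (Orientation G) (λ O → Acyclic (toDigraph O) × Free Fs (toDigraph O))

CycStep : (k : ℕ) → Fin k → Fin k → Set
CycStep k i j = (suc (toℕ i) ≡ toℕ j) ⊎ (suc (toℕ i) ≡ k × toℕ j ≡ 0)

private
  n≢1+n' : ∀ {n} → suc n ≡ n → ⊥
  n≢1+n' {zero} ()
  n≢1+n' {suc n} p = n≢1+n' {n} (suc-injective p)
  one≢3+m : ∀ {m} → suc zero ≡ suc (suc (suc m)) → ⊥
  one≢3+m ()

  step-irr : ∀ m (i : Fin (3 + m)) → ¬ CycStep (3 + m) i i
  step-irr m i (inj₁ p) = n≢1+n' p
  step-irr m i (inj₂ (p , q)) rewrite q = one≢3+m p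

-- The cycle C_{m+3} on vertex set Fin (m + 3)
Cyc : ℕ → Graph
Cyc m = record
  { size = 3 + m
  ; E = λ i j → CycStep (3 + m) i j ⊎ CycStep (3 + m) j i
  ; sym = swap
  ; irrefl = λ { {i} (inj₁ s) → step-irr m i s ; {i} (inj₂ s) → step-irr m i s } }

InCyc : (Graph → Set) → ℕ → Set
InCyc P k = 3 ≤ k × P (Cyc (k ∸ 3))

CycInfinite : (Graph → Set) → Set
CycInfinite P = ∀ N → Σ ℕ λ k → N ≤ k × InCyc P k

-- Let k exceed the size of every forbidden oriented graph, C_k ∈ P and q ≥ 1. By additivity
-- the disjoint union of q·2^k copies of C_k lies in P, so it has an admissible orientation D.
-- The orientation of a copy is determined by the directions of its k edges i(i+1), so by
-- pigeonhole some q copies are oriented alike, say as O. Orient C_{qk} by pulling O back along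
-- the covering C_{qk} → C_k, i ↦ i mod k. An induced copy of a forbidden F has fewer than k
-- vertices, so it misses some residue t; deleting the vertices ≡ t leaves q paths, each mapped
-- isomorphically into C_k, and sending the j-th path into the j-th chosen copy embeds F into D.
-- If D is acyclic, O has a sink s; a directed cycle of the pull-back avoids the residue s, so it
-- lies on one path and projects to a directed cycle of O. The converse is the case q = 1.

module Submission where

open import Defs hiding (sym)
open import Data.Bool using (Bool; true; false; _≟_)
open import Data.Empty using (⊥-elim)
open import Data.Fin as Fin
  using (Fin; zero; suc; toℕ; fromℕ; fromℕ<; inject₁; inject≤; opposite; _↑ˡ_; _↑ʳ_; splitAt)
open import Data.Fin.Induction using (<-weakInduction; >-weakInduction)
open import Data.Fin.Properties
  using ( toℕ-injective; toℕ-fromℕ<; toℕ<n; toℕ-inject₁; toℕ-fromℕ; inject≤-injective; opposite-involutive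
        ; ↑ˡ-injective; ↑ʳ-injective; splitAt-↑ˡ; splitAt-↑ʳ; any?; ¬∀⟶∃¬; injective⇒≤)
open import Data.Fin.Relation.Unary.Top using (view; ‵fromℕ; ‵inject₁)
open import Data.List using (List; []; _∷_; length; filter; lookup; allFin; map)
open import Data.List.Membership.Propositional using (_∈_)
open import Data.List.Membership.Propositional.Properties using (∈-filter⁻; ∈-lookup)
open import Data.List.Properties using (length-tabulate)
open import Data.List.Relation.Unary.All as All using ()
open import Data.List.Relation.Unary.AllPairs using (_∷_)
open import Data.List.Relation.Unary.Any using (here; there)
open import Data.List.Relation.Unary.Unique.Propositional using (Unique)
open import Data.List.Relation.Unary.Unique.Propositional.Properties using (filter⁺; allFin⁺)
open import Data.Nat using (ℕ; zero; suc; _+_; _*_; _∸_; _^_; _≤_; _<_; _%_; _/_; NonZero; s≤s; z≤n; _≤?_)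
open import Data.Nat.DivMod
open import Data.Nat.Divisibility using (_∣_; n∣m*n)
open import Data.Nat.ListAction using (sum)
open import Data.Nat.Properties hiding (_≟_)
open import Data.Product using (Σ; ∃; ∃₂; _×_; _,_; proj₁; proj₂; map₂)
open import Data.Sum using (_⊎_; inj₁; inj₂; [_,_]′)
open import Data.Vec.Functional as Vector using ()
open import Function.Base using (_∘_)
open import Function.Bundles using (_⇔_; mk⇔; Equivalence)
open import Function.Definitions using (Injective)
open import Relation.Binary.PropositionalEquality
open import Relation.Nullary using (¬_; yes; no; _×-dec_; contradiction)

open Equivalence using (to; from)

[m%n+o]%n≡[m+o]%n : ∀ m o n .{{_ : NonZero n}} → (m % n + o) % n ≡ (m + o) % n
[m%n+o]%n≡[m+o]%n m o n = begin
  (m % n + o) % n          ≡⟨ %-distribˡ-+ (m % n) o n ⟩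
  (m % n % n + o % n) % n  ≡⟨ cong (λ x → (x + o % n) % n) (m%n%n≡m%n m n) ⟩
  (m % n + o % n) % n      ≡⟨ %-distribˡ-+ m o n ⟨
  (m + o) % n              ∎
  where open ≡-Reasoning

[1+m%n]%n≡[1+m]%n : ∀ m n .{{_ : NonZero n}} → suc (m % n) % n ≡ suc m % n
[1+m%n]%n≡[1+m]%n m n = begin
  suc (m % n) % n  ≡⟨ cong (_% n) (+-comm 1 (m % n)) ⟩
  (m % n + 1) % n  ≡⟨ [m%n+o]%n≡[m+o]%n m 1 n ⟩
  (m + 1) % n      ≡⟨ cong (_% n) (+-comm m 1) ⟩
  suc m % n        ∎
  where open ≡-Reasoning

m<n⇒[m+kn]/n≡k : ∀ r k n .{{_ : NonZero n}} → r < n → (r + k * n) / n ≡ k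
m<n⇒[m+kn]/n≡k r k n r<n = begin
  (r + k * n) / n    ≡⟨ +-distrib-/-∣ʳ r (n∣m*n k) ⟩
  r / n + k * n / n  ≡⟨ cong₂ _+_ (m<n⇒m/n≡0 r<n) (m*n/n≡m k n) ⟩
  k                  ∎
  where open ≡-Reasoning

m<n⇒[1+m]%n≢0⇒1+m<n : ∀ {m n} .{{_ : NonZero n}} → m < n → suc m % n ≢ 0 → suc m < n
m<n⇒[1+m]%n≢0⇒1+m<n {n = n} m<n [1+m]%n≢0 with m≤n⇒m<n∨m≡n m<n
... | inj₁ 1+m<n = 1+m<n
... | inj₂ refl  = ⊥-elim ([1+m]%n≢0 (n%n≡0 n))

[1+m]%n≢0⇒[1+m]/n≡m/n : ∀ m n .{{_ : NonZero n}} → suc m % n ≢ 0 → suc m / n ≡ m / n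
[1+m]%n≢0⇒[1+m]/n≡m/n m n [1+m]%n≢0 = begin
  suc m / n                          ≡⟨ cong (λ x → suc x / n) (m≡m%n+[m/n]*n m n) ⟩
  (suc (m % n) + m / n * n) / n      ≡⟨ m<n⇒[m+kn]/n≡k (suc (m % n)) (m / n) n 1+m%n<n ⟩
  m / n                              ∎
  where
  open ≡-Reasoning
  1+m%n<n : suc (m % n) < n
  1+m%n<n = m<n⇒[1+m]%n≢0⇒1+m<n (m%n<n m n) (λ eq → [1+m]%n≢0 (trans (sym ([1+m%n]%n≡[1+m]%n m n)) eq))

[1+m]%n≡[1+o]%n⇒m≡o : ∀ {m o k} → m < suc k → o < suc k → suc m % suc k ≡ suc o % suc k → m ≡ o
[1+m]%n≡[1+o]%n⇒m≡o {m} {o} {k} m<1+k o<1+k eq = begin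
  m                              ≡⟨ [1+r+k]%[1+k]≡r m<1+k ⟨
  (suc m + k) % suc k            ≡⟨ [m%n+o]%n≡[m+o]%n (suc m) k (suc k) ⟨
  (suc m % suc k + k) % suc k    ≡⟨ cong (λ z → (z + k) % suc k) eq ⟩
  (suc o % suc k + k) % suc k    ≡⟨ [m%n+o]%n≡[m+o]%n (suc o) k (suc k) ⟩
  (suc o + k) % suc k            ≡⟨ [1+r+k]%[1+k]≡r o<1+k ⟩
  o                              ∎
  where
  open ≡-Reasoning
  [1+r+k]%[1+k]≡r : ∀ {r} → r < suc k → (suc r + k) % suc k ≡ r
  [1+r+k]%[1+k]≡r {r} r<1+k = begin
    (suc r + k) % suc k  ≡⟨ cong (_% suc k) (+-suc r k) ⟨
    (r + suc k) % suc k  ≡⟨ [m+n]%n≡m%n r (suc k) ⟩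
    r % suc k            ≡⟨ m<n⇒m%n≡m r<1+k ⟩
    r                    ∎

-- Deleting the q positions ≡ t (mod K) from the cycle ℤ/qK leaves q paths. Rotating by qK ∸ t
-- moves the deleted positions to the multiples of K, so block x := shift x / K numbers the
-- path containing x.
module Rotation (K q : ℕ) {{_ : NonZero (q * K)}} {t : ℕ} (t<K : t < K) where

  n : ℕ
  n = q * K

  private
    instance
      K≢0 : NonZero K
      K≢0 = m*n≢0⇒n≢0 q

    t≤n : t ≤ n
    t≤n = ≤-trans (<⇒≤ t<K) (m≤n*m K q {{m*n≢0⇒m≢0 q}})

    shift : ℕ → ℕ
    shift x = (x + (n ∸ t)) % n

  block : ℕ → ℕ
  block x = shift x / K

  block<q : ∀ x → block x < q
  block<q x = m<n*o⇒m/o<n (m%n<n (x + (n ∸ t)) n)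

  private
    open ≡-Reasoning

    shift-inverse : ∀ {x} → x < n → (shift x + t) % n ≡ x
    shift-inverse {x} x<n = begin
      ((x + (n ∸ t)) % n + t) % n  ≡⟨ [m%n+o]%n≡[m+o]%n (x + (n ∸ t)) t n ⟩
      (x + (n ∸ t) + t) % n        ≡⟨ cong (_% n) (+-assoc x (n ∸ t) t) ⟩
      (x + (n ∸ t + t)) % n        ≡⟨ cong (λ y → (x + y) % n) (m∸n+n≡m t≤n) ⟩
      (x + n) % n                  ≡⟨ [m+n]%n≡m%n x n ⟩
      x % n                        ≡⟨ m<n⇒m%n≡m x<n ⟩
      x                            ∎

    shift%K : ∀ x → shift x % K ≡ (x + (n ∸ t)) % K
    shift%K x = m∣n⇒o%n%m≡o%m K n (x + (n ∸ t)) (n∣m*n q)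

    shift-decomposition : ∀ x → shift x ≡ shift x % K + block x * K
    shift-decomposition x = m≡m%n+[m/n]*n (shift x) K

    shift%K≢0 : ∀ {x} → x % K ≢ t → shift x % K ≢ 0
    shift%K≢0 {x} x%K≢t shift%K≡0 = x%K≢t (begin
      x % K                             ≡⟨ %-remove-+ʳ x (n∣m*n q) ⟨
      (x + n) % K                       ≡⟨ cong (λ y → (x + y) % K) (m∸n+n≡m t≤n) ⟨
      (x + (n ∸ t + t)) % K             ≡⟨ cong (_% K) (+-assoc x (n ∸ t) t) ⟨
      (x + (n ∸ t) + t) % K             ≡⟨ [m%n+o]%n≡[m+o]%n (x + (n ∸ t)) t K ⟨
      ((x + (n ∸ t)) % K + t) % K       ≡⟨ cong (λ y → (y + t) % K) (trans (sym (shift%K x)) shift%K≡0) ⟩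
      t % K                             ≡⟨ m<n⇒m%n≡m t<K ⟩
      t                                 ∎)

    shift-suc : ∀ x → shift (suc x % n) ≡ suc (shift x) % n
    shift-suc x = begin
      (suc x % n + (n ∸ t)) % n  ≡⟨ [m%n+o]%n≡[m+o]%n (suc x) (n ∸ t) n ⟩
      suc (x + (n ∸ t)) % n      ≡⟨ [1+m%n]%n≡[1+m]%n (x + (n ∸ t)) n ⟨
      suc (shift x) % n          ∎

  residue-block-injective : ∀ {x y} → x < n → y < n → x % K ≡ y % K → block x ≡ block y → x ≡ y
  residue-block-injective {x} {y} x<n y<n x%K≡y%K bx≡by = begin
    x                  ≡⟨ shift-inverse x<n ⟨
    (shift x + t) % n  ≡⟨ cong (λ z → (z + t) % n) shift-x≡shift-y ⟩
    (shift y + t) % n  ≡⟨ shift-inverse y<n ⟩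
    y                  ∎
    where
    shift-x%K≡shift-y%K : shift x % K ≡ shift y % K
    shift-x%K≡shift-y%K = begin
      shift x % K                   ≡⟨ shift%K x ⟩
      (x + (n ∸ t)) % K             ≡⟨ [m%n+o]%n≡[m+o]%n x (n ∸ t) K ⟨
      (x % K + (n ∸ t)) % K         ≡⟨ cong (λ z → (z + (n ∸ t)) % K) x%K≡y%K ⟩
      (y % K + (n ∸ t)) % K         ≡⟨ [m%n+o]%n≡[m+o]%n y (n ∸ t) K ⟩
      (y + (n ∸ t)) % K             ≡⟨ shift%K y ⟨
      shift y % K                   ∎
    shift-x≡shift-y : shift x ≡ shift y
    shift-x≡shift-y = begin
      shift x                    ≡⟨ shift-decomposition x ⟩
      shift x % K + block x * K  ≡⟨ cong₂ (λ r b → r + b * K) shift-x%K≡shift-y%K bx≡by ⟩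
      shift y % K + block y * K  ≡⟨ shift-decomposition y ⟨
      shift y                    ∎

  step⇒same-block : ∀ {x y} → y % K ≢ t → y ≡ suc x % n → block x ≡ block y
  step⇒same-block {x} {y} y%K≢t refl = sym (begin
    shift (suc x % n) / K   ≡⟨ cong (_/ K) (shift-suc x) ⟩
    suc (shift x) % n / K   ≡⟨ cong (_/ K) (m<n⇒m%n≡m 1+shift-x<n) ⟩
    suc (shift x) / K       ≡⟨ [1+m]%n≢0⇒[1+m]/n≡m/n (shift x) K 1+shift-x%K≢0 ⟩
    shift x / K             ∎)
    where
    shift-y%K≢0 : shift (suc x % n) % K ≢ 0
    shift-y%K≢0 = shift%K≢0 y%K≢t
    1+shift-x<n : suc (shift x) < n
    1+shift-x<n = m<n⇒[1+m]%n≢0⇒1+m<n (m%n<n (x + (n ∸ t)) n)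
      (λ eq → shift-y%K≢0 (trans (cong (_% K) (trans (shift-suc x) eq)) (m*n%n≡0 0 K)))
    1+shift-x%K≢0 : suc (shift x) % K ≢ 0
    1+shift-x%K≢0 eq = shift-y%K≢0 (begin
      shift (suc x % n) % K      ≡⟨ cong (_% K) (shift-suc x) ⟩
      suc (shift x) % n % K      ≡⟨ cong (_% K) (m<n⇒m%n≡m 1+shift-x<n) ⟩
      suc (shift x) % K          ≡⟨ eq ⟩
      0                          ∎)

  same-block⇒step : ∀ {x y} → x < n → y < n → y % K ≢ t → block x ≡ block y
                  → y % K ≡ suc (x % K) % K → y ≡ suc x % n
  same-block⇒step {x} {y} x<n y<n y%K≢t bx≡by y%K≡1+x%K = begin
    y                            ≡⟨ shift-inverse y<n ⟨
    (shift y + t) % n            ≡⟨ cong (λ z → (z + t) % n) shift-y≡1+shift-x ⟩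
    suc (shift x + t) % n        ≡⟨ [1+m%n]%n≡[1+m]%n (shift x + t) n ⟨
    suc ((shift x + t) % n) % n  ≡⟨ cong (λ z → suc z % n) (shift-inverse x<n) ⟩
    suc x % n                    ∎
    where
    shift-y%K≡[1+shift-x%K]%K : shift y % K ≡ suc (shift x % K) % K
    shift-y%K≡[1+shift-x%K]%K = begin
      shift y % K                          ≡⟨ shift%K y ⟩
      (y + (n ∸ t)) % K                    ≡⟨ [m%n+o]%n≡[m+o]%n y (n ∸ t) K ⟨
      (y % K + (n ∸ t)) % K                ≡⟨ cong (λ z → (z + (n ∸ t)) % K) y%K≡1+x%K ⟩
      (suc (x % K) % K + (n ∸ t)) % K      ≡⟨ [m%n+o]%n≡[m+o]%n (suc (x % K)) (n ∸ t) K ⟩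
      suc (x % K + (n ∸ t)) % K            ≡⟨ [1+m%n]%n≡[1+m]%n (x % K + (n ∸ t)) K ⟨
      suc ((x % K + (n ∸ t)) % K) % K      ≡⟨ cong (λ z → suc z % K) ([m%n+o]%n≡[m+o]%n x (n ∸ t) K) ⟩
      suc ((x + (n ∸ t)) % K) % K          ≡⟨ cong (λ z → suc z % K) (shift%K x) ⟨
      suc (shift x % K) % K                ∎
    1+shift-x%K<K : suc (shift x % K) < K
    1+shift-x%K<K = m<n⇒[1+m]%n≢0⇒1+m<n (m%n<n (shift x) K)
      (λ eq → shift%K≢0 y%K≢t (trans shift-y%K≡[1+shift-x%K]%K eq))
    shift-y≡1+shift-x : shift y ≡ suc (shift x)
    shift-y≡1+shift-x = begin
      shift y                          ≡⟨ shift-decomposition y ⟩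
      shift y % K + block y * K        ≡⟨ cong₂ (λ r b → r + b * K) shift-y%K≡1+shift-x%K (sym bx≡by) ⟩
      suc (shift x % K) + block x * K  ≡⟨ cong suc (shift-decomposition x) ⟨
      suc (shift x)                    ∎
      where
      shift-y%K≡1+shift-x%K : shift y % K ≡ suc (shift x % K)
      shift-y%K≡1+shift-x%K = trans shift-y%K≡[1+shift-x%K]%K (m<n⇒m%n≡m 1+shift-x%K<K)

next : ∀ {k} → Fin (suc k) → Fin (suc k)
next {k} i = suc (toℕ i) mod suc k

toℕ-next : ∀ {k} (i : Fin (suc k)) → toℕ (next i) ≡ suc (toℕ i) % suc k
toℕ-next i = toℕ-fromℕ< _

CycStep⇔toℕ : ∀ {k} {i j : Fin (suc k)} → CycStep (suc k) i j ⇔ toℕ j ≡ suc (toℕ i) % suc k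
CycStep⇔toℕ {k} {i} {j} = mk⇔ step⇒toℕ toℕ⇒step
  where
  step⇒toℕ : CycStep (suc k) i j → toℕ j ≡ suc (toℕ i) % suc k
  step⇒toℕ (inj₁ 1+i≡j)        =
    trans (sym 1+i≡j) (sym (m<n⇒m%n≡m (subst (_< suc k) (sym 1+i≡j) (toℕ<n j))))
  step⇒toℕ (inj₂ (1+i≡n , j≡0)) = trans j≡0 (sym (trans (cong (_% suc k) 1+i≡n) (n%n≡0 (suc k))))
  toℕ⇒step : toℕ j ≡ suc (toℕ i) % suc k → CycStep (suc k) i j
  toℕ⇒step eq with m≤n⇒m<n∨m≡n (toℕ<n i)
  ... | inj₁ 1+i<n = inj₁ (sym (trans eq (m<n⇒m%n≡m 1+i<n)))
  ... | inj₂ 1+i≡n = inj₂ (1+i≡n , trans eq (trans (cong (_% suc k) 1+i≡n) (n%n≡0 (suc k))))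

CycStep⇔next : ∀ {k} {i j : Fin (suc k)} → CycStep (suc k) i j ⇔ j ≡ next i
CycStep⇔next {i = i} = mk⇔
  (λ step → toℕ-injective (trans (to CycStep⇔toℕ step) (sym (toℕ-next i))))
  (λ { refl → from CycStep⇔toℕ (toℕ-next i) })

next-injective : ∀ {k} {i j : Fin (suc k)} → next i ≡ next j → i ≡ j
next-injective {i = i} {j} eq = toℕ-injective ([1+m]%n≡[1+o]%n⇒m≡o (toℕ<n i) (toℕ<n j)
  (trans (sym (toℕ-next i)) (trans (cong toℕ eq) (toℕ-next j))))

next-inject₁ : ∀ {k} (i : Fin k) → next (inject₁ i) ≡ suc i
next-inject₁ {k} i = toℕ-injective (begin
  toℕ (next (inject₁ i))           ≡⟨ toℕ-next (inject₁ i) ⟩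
  suc (toℕ (inject₁ i)) % suc k    ≡⟨ cong (λ z → suc z % suc k) (toℕ-inject₁ i) ⟩
  suc (toℕ i) % suc k              ≡⟨ m<n⇒m%n≡m (s≤s (toℕ<n i)) ⟩
  suc (toℕ i)                      ∎)
  where open ≡-Reasoning

next-fromℕ : ∀ k → next (fromℕ k) ≡ zero
next-fromℕ k = toℕ-injective (begin
  toℕ (next (fromℕ k))       ≡⟨ toℕ-next (fromℕ k) ⟩
  suc (toℕ (fromℕ k)) % suc k ≡⟨ cong (λ z → suc z % suc k) (toℕ-fromℕ k) ⟩
  suc k % suc k              ≡⟨ n%n≡0 (suc k) ⟩
  0                          ∎)
  where open ≡-Reasoning

opposite-inject₁ : ∀ {n} (i : Fin (suc n)) → opposite (inject₁ i) ≡ suc (opposite i)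
opposite-inject₁ zero = refl
opposite-inject₁ {suc n} (suc i) = cong inject₁ (opposite-inject₁ i)

opposite-fromℕ : ∀ n → opposite (fromℕ n) ≡ zero
opposite-fromℕ zero    = refl
opposite-fromℕ (suc n) = cong inject₁ (opposite-fromℕ n)

module _ (G : Graph) where

  Copies : ℕ → Graph
  Copies zero    = G
  Copies (suc n) = G ⊕ Copies n

  inCopy : ∀ {n} → Fin (suc n) → Fin (size G) → Fin (size (Copies n))
  inCopy {zero}  zero    x = x
  inCopy {suc n} zero    x = x ↑ˡ size (Copies n)
  inCopy {suc n} (suc c) x = size G ↑ʳ inCopy c x

  E-inCopy : ∀ {n} (c : Fin (suc n)) x y → E (Copies n) (inCopy c x) (inCopy c y) ⇔ E G x y
  E-inCopy {zero}  zero    x y = mk⇔ (λ e → e) (λ e → e)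
  E-inCopy {suc n} zero    x y
    rewrite splitAt-↑ˡ (size G) x (size (Copies n)) | splitAt-↑ˡ (size G) y (size (Copies n))
    = mk⇔ (λ e → e) (λ e → e)
  E-inCopy {suc n} (suc c) x y
    rewrite splitAt-↑ʳ (size G) (size (Copies n)) (inCopy c x) | splitAt-↑ʳ (size G) (size (Copies n)) (inCopy c y)
    = E-inCopy c x y

  E-inCopy⇒≡ : ∀ {n} (c d : Fin (suc n)) x y → E (Copies n) (inCopy c x) (inCopy d y) → c ≡ d
  E-inCopy⇒≡ {zero}  zero    zero    x y e = refl
  E-inCopy⇒≡ {suc n} zero    zero    x y e = refl
  E-inCopy⇒≡ {suc n} zero    (suc d) x y e
    rewrite splitAt-↑ˡ (size G) x (size (Copies n)) | splitAt-↑ʳ (size G) (size (Copies n)) (inCopy d y) = ⊥-elim e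
  E-inCopy⇒≡ {suc n} (suc c) zero    x y e
    rewrite splitAt-↑ʳ (size G) (size (Copies n)) (inCopy c x) | splitAt-↑ˡ (size G) y (size (Copies n)) = ⊥-elim e
  E-inCopy⇒≡ {suc n} (suc c) (suc d) x y e
    rewrite splitAt-↑ʳ (size G) (size (Copies n)) (inCopy c x) | splitAt-↑ʳ (size G) (size (Copies n)) (inCopy d y)
    = cong suc (E-inCopy⇒≡ c d x y e)

  inCopy-injective : ∀ {n} {c d : Fin (suc n)} {x y} → inCopy c x ≡ inCopy d y → c ≡ d × x ≡ y
  inCopy-injective {zero}  {zero}  {zero}  eq = refl , eq
  inCopy-injective {suc n} {zero}  {zero}  eq = refl , ↑ˡ-injective (size (Copies n)) _ _ eq
  inCopy-injective {suc n} {zero}  {suc d} {x} {y} eq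
    with () ← trans (sym (splitAt-↑ˡ (size G) x (size (Copies n))))
                    (trans (cong (splitAt (size G)) eq) (splitAt-↑ʳ (size G) (size (Copies n)) (inCopy d y)))
  inCopy-injective {suc n} {suc c} {zero}  {x} {y} eq
    with () ← trans (sym (splitAt-↑ˡ (size G) y (size (Copies n))))
                    (trans (cong (splitAt (size G)) (sym eq)) (splitAt-↑ʳ (size G) (size (Copies n)) (inCopy c x)))
  inCopy-injective {suc n} {suc c} {suc d} {x} {y} eq
    with refl , x≡y ← inCopy-injective {c = c} {d} {x} {y} (↑ʳ-injective (size G) _ _ eq) = refl , x≡y

  Additive⇒Copies : ∀ {P : Graph → Set} → Additive P → P G → ∀ n → P (Copies n)
  Additive⇒Copies additive PG zero    = PG
  Additive⇒Copies additive PG (suc n) = additive G (Copies n) PG (Additive⇒Copies additive PG n)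

  restrict : ∀ {n} → Orientation (Copies n) → Fin (suc n) → Orientation G
  restrict D c = record
    { arc      = λ x y → arc D (inCopy c x) (inCopy c y)
    ; arc-irr  = arc-irr D
    ; arc-asym = arc-asym D
    ; spans    = λ x y → mk⇔ (λ e → to (spans D _ _) (from (E-inCopy c x y) e))
                             (λ a → to (E-inCopy c x y) (from (spans D _ _) a)) }

  Acyclic-restrict : ∀ {n} (D : Orientation (Copies n)) (c : Fin (suc n))
                   → Acyclic (toDigraph D) → Acyclic (toDigraph (restrict D c))
  Acyclic-restrict D c acyclic (k , cyc , cyc-injective , steps , closing) =
    acyclic ( k , (λ i → inCopy c (cyc i)) , (λ eq → cyc-injective (proj₂ (inCopy-injective {c = c} {c} eq)))
            , steps , closing)

-- Orientations of a cycle

descent-or-constant : ∀ {k} (b : Fin (suc (suc k)) → Bool)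
  → (∃ λ x → b x ≡ true × b (next x) ≡ false) ⊎ (∀ x → b x ≡ true) ⊎ (∀ x → b x ≡ false)
descent-or-constant {k} b with any? (λ x → (b x ≟ true) ×-dec (b (next x) ≟ false))
... | yes descent = inj₁ descent
... | no ¬descent with b zero in b₀
...   | true  = inj₂ (inj₁ (<-weakInduction (λ x → b x ≡ true) b₀ λ i bi →
                  subst (λ x → b x ≡ true) (next-inject₁ i) (true-persists (inject₁ i) bi)))
  where
  true-persists : ∀ x → b x ≡ true → b (next x) ≡ true
  true-persists x bx with b (next x) in b-next
  ... | true  = refl
  ... | false = ⊥-elim (¬descent (x , bx , b-next))
...   | false = inj₂ (inj₂ (>-weakInduction (λ x → b x ≡ false)
                  (false-persists-back (fromℕ (suc k)) (trans (cong b (next-fromℕ (suc k))) b₀))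
                  λ i b-suc → false-persists-back (inject₁ i) (trans (cong b (next-inject₁ i)) b-suc)))
  where
  false-persists-back : ∀ x → b (next x) ≡ false → b x ≡ false
  false-persists-back x b-next with b x in bx
  ... | false = refl
  ... | true  = ⊥-elim (¬descent (x , bx , b-next))

Sink : ∀ {G} → Orientation G → Fin (size G) → Set
Sink O s = ∀ y → ¬ arc O s y

module _ {a : ℕ} where

  edge-next : (x : Fin (3 + a)) → E (Cyc a) x (next x)
  edge-next x = inj₁ (from CycStep⇔next refl)

  forward : Orientation (Cyc a) → Fin (3 + a) → Bool
  forward O x with to (spans O x (next x)) (edge-next x)
  ... | inj₁ _ = true
  ... | inj₂ _ = false

  forward≡true⇔ : ∀ O x → forward O x ≡ true ⇔ arc O x (next x)
  forward≡true⇔ O x with to (spans O x (next x)) (edge-next x)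
  ... | inj₁ fwd = mk⇔ (λ _ → fwd) (λ _ → refl)
  ... | inj₂ bwd = mk⇔ (λ ()) (λ fwd → ⊥-elim (arc-asym O fwd bwd))

  forward≡false⇔ : ∀ O x → forward O x ≡ false ⇔ arc O (next x) x
  forward≡false⇔ O x with to (spans O x (next x)) (edge-next x)
  ... | inj₁ fwd = mk⇔ (λ ()) (λ bwd → ⊥-elim (arc-asym O fwd bwd))
  ... | inj₂ bwd = mk⇔ (λ _ → bwd) (λ _ → refl)

  module _ (O : Orientation (Cyc a)) where

    arc⇒forward : ∀ {x y} → arc O x y
                → (y ≡ next x × forward O x ≡ true) ⊎ (x ≡ next y × forward O y ≡ false)
    arc⇒forward {x} {y} x→y with from (spans O x y) (inj₁ x→y)
    ... | inj₁ step with refl ← to CycStep⇔next step = inj₁ (refl , from (forward≡true⇔ O x) x→y)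
    ... | inj₂ step with refl ← to CycStep⇔next step = inj₂ (refl , from (forward≡false⇔ O y) x→y)

    forward-cycle : (∀ x → arc O x (next x)) → DirectedCycle (toDigraph O)
    forward-cycle fwd = 2 + a , (λ i → i) , (λ eq → eq)
      , (λ i → subst (arc O (inject₁ i)) (next-inject₁ i) (fwd (inject₁ i)))
      , subst (arc O (fromℕ (2 + a))) (next-fromℕ (2 + a)) (fwd (fromℕ (2 + a)))

    backward-cycle : (∀ x → arc O (next x) x) → DirectedCycle (toDigraph O)
    backward-cycle bwd = 2 + a , opposite
      , (λ {i} {j} eq → trans (sym (opposite-involutive i)) (trans (cong opposite eq) (opposite-involutive j)))
      , (λ i → subst (λ x → arc O x (opposite (suc i)))
                     (trans (next-inject₁ (opposite i)) (sym (opposite-inject₁ i)))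
                     (bwd (inject₁ (opposite i))))
      , subst (λ x → arc O x (fromℕ (2 + a))) (trans (next-fromℕ (2 + a)) (sym (opposite-fromℕ (2 + a))))
              (bwd (fromℕ (2 + a)))

    acyclic⇒sink : Acyclic (toDigraph O) → ∃ (Sink O)
    acyclic⇒sink acyclic with descent-or-constant (forward O)
    ... | inj₁ (x , fwd , bwd) = next x , next-x-sink
      where
      next-x-sink : Sink O (next x)
      next-x-sink y next-x→y with arc⇒forward next-x→y
      ... | inj₁ (_ , fwd′) = contradiction (trans (sym fwd′) bwd) λ ()
      ... | inj₂ (eq , _) with refl ← next-injective {i = x} {y} eq =
        arc-asym O (to (forward≡true⇔ O x) fwd) next-x→y
    ... | inj₂ (inj₁ all-fwd) = ⊥-elim (acyclic (forward-cycle λ x → to (forward≡true⇔ O x) (all-fwd x)))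
    ... | inj₂ (inj₂ all-bwd) = ⊥-elim (acyclic (backward-cycle λ x → to (forward≡false⇔ O x) (all-bwd x)))

  forward-≗⇒arc : ∀ {O O′ : Orientation (Cyc a)} → forward O ≗ forward O′
                → ∀ {x y} → arc O x y → arc O′ x y
  forward-≗⇒arc {O} {O′} same {x} {y} x→y with arc⇒forward O x→y
  ... | inj₁ (refl , fwd) = to (forward≡true⇔ O′ x) (trans (sym (same x)) fwd)
  ... | inj₂ (refl , bwd) = to (forward≡false⇔ O′ y) (trans (sym (same y)) bwd)

-- Pigeonhole on direction patterns

module _ {X : Set} where

  length-filter-true+false : (p : X → Bool) (xs : List X)
    → length (filter (λ x → p x ≟ true) xs) + length (filter (λ x → p x ≟ false) xs) ≡ length xs
  length-filter-true+false p []       = refl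
  length-filter-true+false p (x ∷ xs) with p x
  ... | true  = cong suc (length-filter-true+false p xs)
  ... | false = trans (+-suc _ _) (cong suc (length-filter-true+false p xs))

  lookup-injective : ∀ {xs : List X} → Unique xs → ∀ {i j} → lookup xs i ≡ lookup xs j → i ≡ j
  lookup-injective (_  ∷ _) {zero}  {zero}  _  = refl
  lookup-injective (x∉ ∷ _) {zero}  {suc j} eq = ⊥-elim (All.lookup x∉ (∈-lookup j) eq)
  lookup-injective (x∉ ∷ _) {suc i} {zero}  eq = ⊥-elim (All.lookup x∉ (∈-lookup i) (sym eq))
  lookup-injective (_  ∷ u) {suc i} {suc j} eq = cong suc (lookup-injective u eq)

  bool-pigeonhole : (p : X → Bool) (q : ℕ) (xs : List X) → q * 2 ≤ length xs
    → ∃ λ c → q ≤ length (filter (λ x → p x ≟ c) xs)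
  bool-pigeonhole p q xs 2q≤ with q ≤? length (filter (λ x → p x ≟ true) xs)
  ... | yes q≤trues = true , q≤trues
  ... | no  q≰trues = false , +-cancelˡ-≤ q q _ (begin
    q + q          ≡⟨ cong (q +_) (+-identityʳ q) ⟨
    q + (q + 0)    ≡⟨ *-comm 2 q ⟩
    q * 2          ≤⟨ 2q≤ ⟩
    length xs      ≡⟨ length-filter-true+false p xs ⟨
    trues + falses ≤⟨ +-monoˡ-≤ falses (<⇒≤ (≰⇒> q≰trues)) ⟩
    q + falses     ∎)
    where
    open ≤-Reasoning
    trues falses : ℕ
    trues  = length (filter (λ x → p x ≟ true) xs)
    falses = length (filter (λ x → p x ≟ false) xs)

  pattern-pigeonhole : ∀ {K} (b : X → Fin K → Bool) (q : ℕ) (xs : List X) → Unique xs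
    → q * 2 ^ K ≤ length xs
    → ∃₂ λ (v : Fin K → Bool) ys → Unique ys × q ≤ length ys × (∀ {y} → y ∈ ys → ∀ i → b y i ≡ v i)
  pattern-pigeonhole {zero} b q xs xs-unique q≤ =
    (λ ()) , xs , xs-unique , subst (_≤ length xs) (*-identityʳ q) q≤ , λ _ ()
  pattern-pigeonhole {suc K} b q xs xs-unique q≤
    with v , ys , ys-unique , 2q≤ , ys-v ← pattern-pigeonhole (λ y i → b y (suc i)) (q * 2) xs xs-unique
                                             (subst (_≤ length xs) (sym (*-assoc q 2 (2 ^ K))) q≤)
    with c , q≤c ← bool-pigeonhole (λ y → b y zero) q ys 2q≤
    = c Vector.∷ v , filter (λ y → b y zero ≟ c) ys , filter⁺ _ ys-unique , q≤c , filtered-v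
    where
    filtered-v : ∀ {y} → y ∈ filter (λ y → b y zero ≟ c) ys → ∀ i → b y i ≡ (c Vector.∷ v) i
    filtered-v y∈ zero    = proj₂ (∈-filter⁻ (λ y → b y zero ≟ c) {xs = ys} y∈)
    filtered-v y∈ (suc i) = ys-v (proj₁ (∈-filter⁻ (λ y → b y zero ≟ c) {xs = ys} y∈)) i

-- Opaque, as otherwise the conversion checker unfolds the search when comparing its outputs.
opaque
  pattern-pigeonhole-Fin : ∀ {C K} (b : Fin C → Fin K → Bool) (q : ℕ) → q * 2 ^ K ≤ C
    → ∃₂ λ (v : Fin K → Bool) (σ : Fin q → Fin C) → Injective _≡_ _≡_ σ × ∀ i x → b (σ i) x ≡ v x
  pattern-pigeonhole-Fin {C} b q q≤C
    with v , ys , ys-unique , q≤ys , ys-v ← pattern-pigeonhole b q (allFin C) (allFin⁺ C)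
                                              (subst (q * _ ≤_) (sym (length-tabulate (λ i → i))) q≤C)
    = v , σ , σ-injective , λ i → ys-v (∈-lookup (inject≤ i q≤ys))
    where
    σ : Fin q → Fin C
    σ i = lookup ys (inject≤ i q≤ys)
    σ-injective : Injective _≡_ _≡_ σ
    σ-injective eq = inject≤-injective q≤ys q≤ys _ _ (lookup-injective ys-unique eq)

-- Pulling an orientation back along C_{qK} → C_K

<⇒∃-unattained : ∀ {d k} (f : Fin d → Fin k) → d < k → ∃ λ t → ∀ v → f v ≢ t
<⇒∃-unattained {d} {k} f d<k =
  map₂ (λ unattained v fv≡t → unattained (v , fv≡t))
       (¬∀⟶∃¬ k _ (λ t → any? (λ v → f v Fin.≟ t)) ¬surjective)
  where
  ¬surjective : ¬ (∀ t → ∃ λ v → f v ≡ t)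
  ¬surjective hit = ≤⇒≯ (injective⇒≤ section-injective) d<k
    where
    section-injective : Injective _≡_ _≡_ (λ t → proj₁ (hit t))
    section-injective {t} {t′} eq = trans (sym (proj₂ (hit t))) (trans (cong f eq) (proj₂ (hit t′)))

module Lift {a m q : ℕ} (3+m≡q*K : 3 + m ≡ q * (3 + a)) where

  private
    K : ℕ
    K = 3 + a

    instance
      q*K≢0 : NonZero (q * K)
      q*K≢0 = subst NonZero 3+m≡q*K _

    K∣3+m : K ∣ 3 + m
    K∣3+m = subst (K ∣_) (sym 3+m≡q*K) (n∣m*n q)

    toℕ<q*K : (p : Fin (3 + m)) → toℕ p < q * K
    toℕ<q*K p = subst (toℕ p <_) 3+m≡q*K (toℕ<n p)

  reduce : Fin (3 + m) → Fin K
  reduce p = toℕ p mod K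

  private
    toℕ-reduce : ∀ p → toℕ (reduce p) ≡ toℕ p % K
    toℕ-reduce p = toℕ-fromℕ< _

    CycStep⇔toℕ-mod-q*K : ∀ {p p′} → CycStep (3 + m) p p′ ⇔ toℕ p′ ≡ suc (toℕ p) % (q * K)
    CycStep⇔toℕ-mod-q*K = mk⇔
      (λ step → trans (to CycStep⇔toℕ step) (%-congʳ 3+m≡q*K))
      (λ eq → from CycStep⇔toℕ (trans eq (%-congʳ (sym 3+m≡q*K))))

    CycStep-reduce : ∀ {p p′} → CycStep (3 + m) p p′ → CycStep K (reduce p) (reduce p′)
    CycStep-reduce {p} {p′} step = from CycStep⇔toℕ (begin
      toℕ (reduce p′)              ≡⟨ toℕ-reduce p′ ⟩
      toℕ p′ % K                   ≡⟨ cong (_% K) (to CycStep⇔toℕ step) ⟩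
      suc (toℕ p) % (3 + m) % K    ≡⟨ m∣n⇒o%n%m≡o%m K (3 + m) (suc (toℕ p)) K∣3+m ⟩
      suc (toℕ p) % K              ≡⟨ [1+m%n]%n≡[1+m]%n (toℕ p) K ⟨
      suc (toℕ p % K) % K          ≡⟨ cong (λ r → suc r % K) (toℕ-reduce p) ⟨
      suc (toℕ (reduce p)) % K     ∎)
      where open ≡-Reasoning

  E-reduce : ∀ {p p′} → E (Cyc m) p p′ → E (Cyc a) (reduce p) (reduce p′)
  E-reduce (inj₁ step) = inj₁ (CycStep-reduce step)
  E-reduce (inj₂ step) = inj₂ (CycStep-reduce step)

  lift : Orientation (Cyc a) → Orientation (Cyc m)
  lift O = record
    { arc      = Arc
    ; arc-irr  = λ (e , _) → irrefl (Cyc m) e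
    ; arc-asym = λ (_ , o) (_ , o′) → arc-asym O o o′
    ; spans    = λ p p′ → mk⇔ (oriented p p′) (unoriented p p′) }
    where
    Arc : Fin (3 + m) → Fin (3 + m) → Set
    Arc p p′ = E (Cyc m) p p′ × arc O (reduce p) (reduce p′)
    oriented : ∀ p p′ → E (Cyc m) p p′ → Arc p p′ ⊎ Arc p′ p
    oriented p p′ e with to (spans O (reduce p) (reduce p′)) (E-reduce e)
    ... | inj₁ o = inj₁ (e , o)
    ... | inj₂ o = inj₂ (Graph.sym (Cyc m) e , o)
    unoriented : ∀ p p′ → Arc p p′ ⊎ Arc p′ p → E (Cyc m) p p′
    unoriented p p′ (inj₁ (e , _)) = e
    unoriented p p′ (inj₂ (e , _)) = Graph.sym (Cyc m) e

  module Cut (t : Fin K) where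

    open Rotation K q (toℕ<n t)

    blockOf : Fin (3 + m) → Fin q
    blockOf p = fromℕ< (block<q (toℕ p))

    private
      blockOf⇔block : ∀ {p p′} → blockOf p ≡ blockOf p′ ⇔ block (toℕ p) ≡ block (toℕ p′)
      blockOf⇔block {p} {p′} = mk⇔
        (λ eq → trans (sym (toℕ-blockOf p)) (trans (cong toℕ eq) (toℕ-blockOf p′)))
        (λ eq → toℕ-injective (trans (toℕ-blockOf p) (trans eq (sym (toℕ-blockOf p′)))))
        where
        toℕ-blockOf : ∀ p → toℕ (blockOf p) ≡ block (toℕ p)
        toℕ-blockOf p = toℕ-fromℕ< (block<q (toℕ p))

      residue≢t : ∀ p → reduce p ≢ t → toℕ p % K ≢ toℕ t
      residue≢t p uncut eq = uncut (toℕ-injective (trans (toℕ-reduce p) eq))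

      same-block⇒CycStep : ∀ p p′ → reduce p′ ≢ t → blockOf p ≡ blockOf p′
                         → CycStep K (reduce p) (reduce p′) → CycStep (3 + m) p p′
      same-block⇒CycStep p p′ uncut′ b≡ step = from CycStep⇔toℕ-mod-q*K
        (same-block⇒step (toℕ<q*K p) (toℕ<q*K p′) (residue≢t p′ uncut′) (to blockOf⇔block b≡) residue-step)
        where
        residue-step : toℕ p′ % K ≡ suc (toℕ p % K) % K
        residue-step = begin
          toℕ p′ % K                ≡⟨ toℕ-reduce p′ ⟨
          toℕ (reduce p′)           ≡⟨ to CycStep⇔toℕ step ⟩
          suc (toℕ (reduce p)) % K  ≡⟨ cong (λ r → suc r % K) (toℕ-reduce p) ⟩
          suc (toℕ p % K) % K       ∎
          where open ≡-Reasoning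

    reduce-blockOf-injective : ∀ {p p′} → reduce p ≡ reduce p′ → blockOf p ≡ blockOf p′ → p ≡ p′
    reduce-blockOf-injective {p} {p′} r≡ b≡ = toℕ-injective
      (residue-block-injective (toℕ<q*K p) (toℕ<q*K p′)
        (trans (sym (toℕ-reduce p)) (trans (cong toℕ r≡) (toℕ-reduce p′))) (to blockOf⇔block b≡))

    E⇒same-block : ∀ p p′ → reduce p ≢ t → reduce p′ ≢ t → E (Cyc m) p p′ → blockOf p ≡ blockOf p′
    E⇒same-block p p′ _ uncut′ (inj₁ step) =
      from blockOf⇔block (step⇒same-block (residue≢t p′ uncut′) (to CycStep⇔toℕ-mod-q*K step))
    E⇒same-block p p′ uncut _ (inj₂ step) =
      sym (from blockOf⇔block (step⇒same-block (residue≢t p uncut) (to CycStep⇔toℕ-mod-q*K step)))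

    same-block⇒E : ∀ p p′ → reduce p ≢ t → reduce p′ ≢ t → blockOf p ≡ blockOf p′
                 → E (Cyc a) (reduce p) (reduce p′) → E (Cyc m) p p′
    same-block⇒E p p′ _     uncut′ b≡ (inj₁ step) = inj₁ (same-block⇒CycStep p p′ uncut′ b≡ step)
    same-block⇒E p p′ uncut _      b≡ (inj₂ step) = inj₂ (same-block⇒CycStep p′ p uncut (sym b≡) step)

  lift-acyclic : ∀ O → Acyclic (toDigraph O) → Acyclic (toDigraph (lift O))
  lift-acyclic O acyclic (k , c , c-injective , steps , closing) =
    acyclic (k , (λ i → reduce (c i)) , reduce∘c-injective , (λ i → proj₂ (steps i)) , proj₂ closing)
    where
    s : Fin K
    s = proj₁ (acyclic⇒sink O acyclic)
    s-sink : Sink O s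
    s-sink = proj₂ (acyclic⇒sink O acyclic)
    open Cut s

    -- A vertex of a directed cycle has an out-arc, so its residue is not the sink s.
    uncut : ∀ i → reduce (c i) ≢ s
    uncut i with view i
    ... | ‵fromℕ     = λ eq → s-sink _ (subst (λ x → arc O x (reduce (c zero))) eq (proj₂ closing))
    ... | ‵inject₁ j = λ eq → s-sink _ (subst (λ x → arc O x (reduce (c (suc j)))) eq (proj₂ (steps j)))

    same-block : ∀ i → blockOf (c i) ≡ blockOf (c zero)
    same-block = <-weakInduction (λ i → blockOf (c i) ≡ blockOf (c zero)) refl λ j b≡ →
      trans (sym (E⇒same-block (c (inject₁ j)) (c (suc j)) (uncut _) (uncut _) (proj₁ (steps j)))) b≡

    reduce∘c-injective : Injective _≡_ _≡_ (λ i → reduce (c i))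
    reduce∘c-injective {i} {j} eq = c-injective (reduce-blockOf-injective eq (trans (same-block i) (sym (same-block j))))

  module _ {N} (D : Orientation (Copies (Cyc a) N)) (O : Orientation (Cyc a))
           (σ : Fin q → Fin (suc N)) (σ-injective : Injective _≡_ _≡_ σ)
           (σ-forward : ∀ i → forward (restrict (Cyc a) D (σ i)) ≗ forward O) where

    lift-embedding : ∀ F → dsize F < K → EmbedsInduced F (toDigraph (lift O)) → EmbedsInduced F (toDigraph D)
    lift-embedding F d<K (g , g-injective , g-arc) = g′ , g′-injective , g′-arc
      where
      t : Fin K
      t = proj₁ (<⇒∃-unattained (λ v → reduce (g v)) d<K)
      open Cut t

      uncut : ∀ v → reduce (g v) ≢ t
      uncut = proj₂ (<⇒∃-unattained (λ v → reduce (g v)) d<K)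

      g′ : Fin (dsize F) → Fin (size (Copies (Cyc a) N))
      g′ v = inCopy (Cyc a) (σ (blockOf (g v))) (reduce (g v))

      g′-injective : Injective _≡_ _≡_ g′
      g′-injective {v} {w} eq
        with c≡ , r≡ ← inCopy-injective (Cyc a) {c = σ (blockOf (g v))} {σ (blockOf (g w))} eq =
        g-injective (reduce-blockOf-injective r≡ (σ-injective c≡))

      g′-arc : ∀ v w → A F v w ⇔ arc D (g′ v) (g′ w)
      g′-arc v w = mk⇔ arc⇒ arc⇐
        where
        arc⇒ : A F v w → arc D (g′ v) (g′ w)
        arc⇒ vw with e , o ← to (g-arc v w) vw =
          subst (λ b → arc D (g′ v) (inCopy (Cyc a) (σ b) (reduce (g w))))
                (E⇒same-block (g v) (g w) (uncut v) (uncut w) e)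
                (forward-≗⇒arc (sym ∘ σ-forward (blockOf (g v))) o)
        arc⇐ : arc D (g′ v) (g′ w) → A F v w
        arc⇐ d = from (g-arc v w) (same-block⇒E (g v) (g w) (uncut v) (uncut w) b≡ (from (spans O _ _) (inj₁ o)) , o)
          where
          σb≡ : σ (blockOf (g v)) ≡ σ (blockOf (g w))
          σb≡ = E-inCopy⇒≡ (Cyc a) _ _ _ _ (from (spans D _ _) (inj₁ d))
          b≡ : blockOf (g v) ≡ blockOf (g w)
          b≡ = σ-injective σb≡
          o : arc O (reduce (g v)) (reduce (g w))
          o = forward-≗⇒arc (σ-forward (blockOf (g v)))
                (subst (λ c → arc D (g′ v) (inCopy (Cyc a) c (reduce (g w)))) (sym σb≡) d)

    lift-Free : ∀ {Fs} → (∀ {F} → F ∈ Fs → dsize F < K) → Free Fs (toDigraph D) → Free Fs (toDigraph (lift O))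
    lift-Free small D-free F F∈ F↪lift = D-free F F∈ (lift-embedding F (small F∈) F↪lift)

dsize≤sum : ∀ {F Fs} → F ∈ Fs → dsize F ≤ sum (map dsize Fs)
dsize≤sum {F} {_ ∷ Fs} (here refl) = m≤m+n (dsize F) (sum (map dsize Fs))
dsize≤sum {_} {G ∷ Fs} (there F∈) = ≤-trans (dsize≤sum F∈) (m≤n+m _ (dsize G))

uniform-copies : ∀ {a N} q (D : Orientation (Copies (Cyc a) N)) → suc q * 2 ^ (3 + a) ≤ suc N
  → ∃ λ (σ : Fin (suc q) → Fin (suc N)) → Injective _≡_ _≡_ σ
      × ∀ i → forward (restrict (Cyc a) D (σ i)) ≗ forward (restrict (Cyc a) D (σ zero))
uniform-copies {a} q D enough =
  let _ , σ , σ-injective , σ-v = pattern-pigeonhole-Fin (λ c → forward (restrict (Cyc a) D c)) (suc q) enough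
  in σ , σ-injective , λ i x → trans (σ-v i x) (sym (σ-v zero x))

forbidden : ∀ {P} → ExpressibleByForbiddenOrientations P ⊎ ExpressibleByForbiddenAcyclicOrientations P
          → List ODigraph
forbidden = [ proj₁ , proj₁ ]′

cycle-multiple : ∀ {P} → Additive P
  → (expressible : ExpressibleByForbiddenOrientations P ⊎ ExpressibleByForbiddenAcyclicOrientations P)
  → ∀ {a m} q → (∀ {F} → F ∈ forbidden expressible → dsize F < 3 + a)
  → 3 + m ≡ suc q * (3 + a) → P (Cyc a) → P (Cyc m)
cycle-multiple additive (inj₁ (Fs , ex)) {a} q small 3+m≡q*K PCₐ
  with D , D-free ← to (ex _) (Additive⇒Copies (Cyc a) additive PCₐ (suc q * 2 ^ (3 + a)))
  with σ , σ-injective , σ-uniform ← uniform-copies q D (n≤1+n _)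
  = from (ex _) (lift (restrict (Cyc a) D (σ zero)) , lift-Free D _ σ σ-injective σ-uniform small D-free)
  where open Lift {a} {_} {suc q} 3+m≡q*K
cycle-multiple additive (inj₂ (Fs , ex)) {a} q small 3+m≡q*K PCₐ
  with D , D-acyclic , D-free ← to (ex _) (Additive⇒Copies (Cyc a) additive PCₐ (suc q * 2 ^ (3 + a)))
  with σ , σ-injective , σ-uniform ← uniform-copies q D (n≤1+n _)
  = from (ex _) ( lift (restrict (Cyc a) D (σ zero))
                , lift-acyclic (restrict (Cyc a) D (σ zero)) (Acyclic-restrict (Cyc a) D (σ zero) D-acyclic)
                , lift-Free D _ σ σ-injective σ-uniform small D-free)
  where open Lift {a} {_} {suc q} 3+m≡q*K

lemma12 : (P : Graph → Set) → IsoClosed P → Additive P → Hereditary P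
    → (ExpressibleByForbiddenOrientations P ⊎ ExpressibleByForbiddenAcyclicOrientations P)
    → CycInfinite P
    → Σ ℕ λ M → 1 ≤ M × (∀ k → M ≤ k → (InCyc P k ⇔ (∀ q → 1 ≤ q → InCyc P (q * k))))
lemma12 P _ additive _ expressible _ = suc bound , s≤s z≤n , λ k M≤k → mk⇔ (multiples k M≤k) divisor
  where
  bound : ℕ
  bound = sum (map dsize (forbidden expressible))
  divisor : ∀ {k} → (∀ q → 1 ≤ q → InCyc P (q * k)) → InCyc P k
  divisor {k} all = subst (InCyc P) (*-identityˡ k) (all 1 (s≤s z≤n))
  multiples : ∀ k → suc bound ≤ k → InCyc P k → ∀ q → 1 ≤ q → InCyc P (q * k)
  multiples k M≤k (3≤k , PCₖ) (suc q) _ = 3≤qk , cycle-multiple additive expressible q small eqn PCₖ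
    where
    3≤qk : 3 ≤ suc q * k
    3≤qk = ≤-trans 3≤k (m≤m+n k (q * k))
    k≡3+a : k ≡ 3 + (k ∸ 3)
    k≡3+a = sym (m+[n∸m]≡n 3≤k)
    eqn : 3 + (suc q * k ∸ 3) ≡ suc q * (3 + (k ∸ 3))
    eqn = trans (m+[n∸m]≡n 3≤qk) (cong (suc q *_) k≡3+a)
    small : ∀ {F} → F ∈ forbidden expressible → dsize F < 3 + (k ∸ 3)
    small F∈ = subst (_ <_) k≡3+a (≤-trans (s≤s (dsize≤sum F∈)) M≤k)
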